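{- For $n\ge 2$ let $G_n$ be the graph with vertex set $\{x,y,z_1,\dots,z_n\}$ and edge set $\{xy\}\cup\{xz_i, yz_i : 1\le i\le n\}$. If $n\ge 5$, then ${\rm mdim}(G_n)-{\rm mdim}(S(G_n))\ge 2$.
   Context: For a connected graph $H$, $d_H$ is the usual distance; for a vertex $v$ and an edge $e=ww'$, $d_H(e,v)=\min\{d_H(w,v),d_H(w',v)\}$. A set $S\subseteq V(H)$ is a mixed resolving set if for every two distinct elements $x,y\in V(H)\cup E(H)$ there is $v\in S$ with $d_H(x,v)\ne d_H(y,v)$; ${\rm mdim}(H)$ is the minimum cardinality of a mixed resolving set. $S(G)$ denotes the subdivision graph of $G$, obtained by subdividing every edge of $G$ once. -}

module Defs where

open import Data.Nat using (ℕ; zero; suc; _≤_; _⊓_)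
open import Data.Fin using (Fin)
open import Data.Bool using (Bool; true; false)
open import Data.Product using (Σ; _×_; _,_; proj₁; proj₂; ∃-syntax)
open import Data.Sum using (_⊎_; inj₁; inj₂)
open import Data.List using (List; length)
open import Data.List.Membership.Propositional using (_∈_)
open import Data.List.Relation.Unary.Unique.Propositional using (Unique)
open import Relation.Binary.PropositionalEquality using (_≡_; _≢_)


record Graph : Set₁ where
  field
    V    : Set
    E    : Set
    ends : E → V × V

open Graph public

Adj : (H : Graph) → V H → V H → Set
Adj H u v = Σ (E H) λ e → (ends H e ≡ (u , v)) ⊎ (ends H e ≡ (v , u))

data Walk (H : Graph) : V H → V H → ℕ → Set where
  nil  : ∀ {u} → Walk H u u 0
  step : ∀ {u w v k} → Adj H u w → Walk H w v k → Walk H u v (suc k)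

Dist : (H : Graph) → V H → V H → ℕ → Set
Dist H u v k = Walk H u v k × (∀ j → Walk H u v j → k ≤ j)

Elem : Graph → Set
Elem H = V H ⊎ E H

DistEl : (H : Graph) → Elem H → V H → ℕ → Set
DistEl H (inj₁ u) v k = Dist H u v k
DistEl H (inj₂ e) v k =
  Σ ℕ λ a → Σ ℕ λ b →
    Dist H (proj₁ (ends H e)) v a × Dist H (proj₂ (ends H e)) v b × k ≡ a ⊓ b

MixedResolving : (H : Graph) → List (V H) → Set
MixedResolving H S =
  (x y : Elem H) → x ≢ y →
    Σ (V H) λ v → v ∈ S × (Σ ℕ λ a → Σ ℕ λ b → DistEl H x v a × DistEl H y v b × a ≢ b)

IsMDim : Graph → ℕ → Set
IsMDim H k =
  (Σ (List (V H)) λ S → Unique S × MixedResolving H S × length S ≡ k)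
  × (∀ (S : List (V H)) → Unique S → MixedResolving H S → k ≤ length S)

-- subdivision graph: new vertex for each edge e = (a,b); edge e splits into (e,false) = a–e and (e,true) = e–b
subdivEnds : (H : Graph) → E H × Bool → (V H ⊎ E H) × (V H ⊎ E H)
subdivEnds H (e , false) = inj₁ (proj₁ (ends H e)) , inj₂ e
subdivEnds H (e , true)  = inj₂ e , inj₁ (proj₂ (ends H e))

Subdiv : Graph → Graph
Subdiv H = record { V = V H ⊎ E H ; E = E H × Bool ; ends = subdivEnds H }

data GV (n : ℕ) : Set where
  x y : GV n
  z   : Fin n → GV n

data GE (n : ℕ) : Set where
  xy : GE n
  xz yz : Fin n → GE n

GEnds : (n : ℕ) → GE n → GV n × GV n
GEnds n xy     = x , y
GEnds n (xz i) = x , z i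
GEnds n (yz i) = y , z i

G : ℕ → Graph
G n = record { V = GV n ; E = GE n ; ends = GEnds n }

module Submission where

-- The distances of G n and S(G n) are written down explicitly; a function vanishing on the
-- diagonal, 1-Lipschitz along edges and realised by walks is the graph distance.
-- In G n every vertex is needed: x alone separates y from the edge x y, y alone separates x
-- from x y, and z i alone separates x from x z_i; all vertices together resolve, so
-- mdim (G n) = n + 2.  In S(G n) the vertex x is separated from the half-edge x a_i only by
-- the three vertices a_i, z_i, b_i of the i-th branch, so a resolving set meets every branch.
-- Conversely, for n ≥ 4, one landmark per branch (a_i on two branches, b_i on the others)
-- resolves: the distance of an element to the landmark of branch j takes a "near" value on
-- its own branch and a "far" value elsewhere, and these values determine the element.
-- Hence mdim (S(G n)) = n.

open import Defs
open import Data.Bool using (true; false)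
open import Data.Empty using (⊥; ⊥-elim)
open import Data.Fin using (Fin; zero; suc)
open import Data.Fin.Properties using (_≟_; ¬∀⟶∃¬; injective⇒≤)
open import Data.List using (List; length; lookup; tabulate)
open import Data.List.Membership.Propositional using (_∈_)
open import Data.List.Membership.Propositional.Properties using (∈-tabulate⁺)
open import Data.List.Properties using (length-tabulate)
open import Data.List.Relation.Unary.Any using (index)
open import Data.List.Relation.Unary.Any.Properties using (lookup-index)
open import Data.List.Relation.Unary.Unique.Propositional.Properties using (tabulate⁺)
open import Data.Maybe using (Maybe; just; nothing)
open import Data.Maybe.Properties using (just-injective)
open import Data.Nat using (ℕ; zero; suc; _≤_; _<_; _+_; _⊓_; _∸_; z≤n; s≤s; _≤?_)
import Data.Nat.Properties as ℕ
open import Data.Product using (Σ; _×_; _,_; proj₁; proj₂)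
open import Data.Sum using (inj₁; inj₂)
open import Function using (_∘_; id)
open import Function.Definitions using (Injective)
open import Relation.Binary.PropositionalEquality
open ≡-Reasoning
open import Relation.Binary.Definitions using (DecidableEquality)
open import Relation.Nullary using (¬_; yes; no; contradiction)
open import Relation.Nullary.Decidable using (True; toWitness)

≤-eval : ∀ {m n} {m≤n : True (m ≤? n)} → m ≤ n
≤-eval {m≤n = m≤n} = toWitness m≤n

ifEq : {A : Set} {n : ℕ} → Fin n → Fin n → A → A → A
ifEq i j a b with i ≟ j
... | yes _ = a
... | no _  = b

ifEq-refl : ∀ {A : Set} {n} (i : Fin n) (a b : A) → ifEq i i a b ≡ a
ifEq-refl i a b with i ≟ i
... | yes _  = refl
... | no i≢i = contradiction refl i≢i

ifEq-≢ : ∀ {A : Set} {n} {i j : Fin n} (a b : A) → i ≢ j → ifEq i j a b ≡ b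
ifEq-≢ {i = i} {j} a b i≢j with i ≟ j
... | yes i≡j = contradiction i≡j i≢j
... | no _    = refl

ifEq-≡-diagonal⇒≡ : ∀ {n} {a b : ℕ} (f : ℕ → ℕ) (i j : Fin n) →
  f a ≢ f b → f (ifEq i i a b) ≡ f (ifEq j i a b) → j ≡ i
ifEq-≡-diagonal⇒≡ f i j fa≢fb eq with j ≟ i
... | yes j≡i = j≡i
... | no _    = contradiction (trans (cong f (sym (ifEq-refl i _ _))) eq) fa≢fb

length-≥-disjoint : ∀ {A : Set} {k} (S : List A) (P : Fin k → A → Set) →
  (∀ {i j w} → P i w → P j w → i ≡ j) →
  (∀ i → Σ A λ w → w ∈ S × P i w) → k ≤ length S
length-≥-disjoint S P disjoint witness = injective⇒≤ slot-injective
  where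
  slot : ∀ i → Fin (length S)
  slot i = index (proj₁ (proj₂ (witness i)))

  witness-at-slot : ∀ i → proj₁ (witness i) ≡ lookup S (slot i)
  witness-at-slot i = lookup-index (proj₁ (proj₂ (witness i)))

  slot-injective : Injective _≡_ _≡_ slot
  slot-injective {i} {j} same = disjoint (proj₂ (proj₂ (witness i))) Pj
    where
    Pj : P j (proj₁ (witness i))
    Pj = subst (P j)
      (trans (witness-at-slot j) (trans (cong (lookup S) (sym same)) (sym (witness-at-slot i))))
      (proj₂ (proj₂ (witness j)))

module ExactDistance (H : Graph) (d : V H → V H → ℕ)
  (d-refl : ∀ v → d v v ≡ 0)
  (d-lipschitz : ∀ {u w} → Adj H u w → ∀ v → d u v ≤ suc (d w v))
  (d-realised : ∀ u v → Walk H u v (d u v)) where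

  d≤length : ∀ {u v k} → Walk H u v k → d u v ≤ k
  d≤length {v = v} nil rewrite d-refl v = z≤n
  d≤length {v = v} (step u~w walk) = ℕ.≤-trans (d-lipschitz u~w v) (s≤s (d≤length walk))

  Dist-d : ∀ u v → Dist H u v (d u v)
  Dist-d u v = d-realised u v , λ _ walk → d≤length walk

  Dist⇒≡d : ∀ {u v k} → Dist H u v k → k ≡ d u v
  Dist⇒≡d {u} {v} (walk , shortest) = ℕ.≤-antisym (shortest _ (d-realised u v)) (d≤length walk)

  elemDist : Elem H → V H → ℕ
  elemDist (inj₁ u) v = d u v
  elemDist (inj₂ e) v = d (proj₁ (ends H e)) v ⊓ d (proj₂ (ends H e)) v

  DistEl-elemDist : ∀ p v → DistEl H p v (elemDist p v)
  DistEl-elemDist (inj₁ u) v = Dist-d u v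
  DistEl-elemDist (inj₂ e) v = _ , _ , Dist-d _ v , Dist-d _ v , refl

  DistEl⇒≡elemDist : ∀ p v {k} → DistEl H p v k → k ≡ elemDist p v
  DistEl⇒≡elemDist (inj₁ u) v du = Dist⇒≡d du
  DistEl⇒≡elemDist (inj₂ e) v (_ , _ , da , db , refl) = cong₂ _⊓_ (Dist⇒≡d da) (Dist⇒≡d db)

  Separates : List (V H) → Elem H → Elem H → Set
  Separates S p q = Σ (V H) λ w → w ∈ S × elemDist p w ≢ elemDist q w

  resolving⇒separates : ∀ {S} → MixedResolving H S → ∀ {p q} → p ≢ q → Separates S p q
  resolving⇒separates resolving {p} {q} p≢q with resolving p q p≢q
  ... | w , w∈S , _ , _ , dp , dq , dp≢dq
    rewrite DistEl⇒≡elemDist p w dp | DistEl⇒≡elemDist q w dq = w , w∈S , dp≢dq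

  tabulate-resolving : ∀ {k} (L : Fin k → V H) →
    (∀ p q → (∀ j → elemDist p (L j) ≡ elemDist q (L j)) → p ≡ q) →
    MixedResolving H (tabulate L)
  tabulate-resolving {k} L determined p q p≢q
    with ¬∀⟶∃¬ k (λ j → elemDist p (L j) ≡ elemDist q (L j))
                  (λ j → elemDist p (L j) ℕ.≟ elemDist q (L j))
                  (λ agree → p≢q (determined p q agree))
  ... | j , differ = L j , ∈-tabulate⁺ j , _ , _ ,
                     DistEl-elemDist p (L j) , DistEl-elemDist q (L j) , differ

  SeparatedOnlyWithin : (V H → Set) → Set
  SeparatedOnlyWithin P =
    Σ (Elem H) λ p → Σ (Elem H) λ q → p ≢ q × (∀ w → elemDist p w ≢ elemDist q w → P w)

  resolving-length-≥ : ∀ {k} (P : Fin k → V H → Set) →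
    (∀ {i j w} → P i w → P j w → i ≡ j) → (∀ i → SeparatedOnlyWithin (P i)) →
    ∀ S → MixedResolving H S → k ≤ length S
  resolving-length-≥ P disjoint forced S resolving = length-≥-disjoint S P disjoint witness
    where
    witness : ∀ i → Σ (V H) λ w → w ∈ S × P i w
    witness i with forced i
    ... | p , q , p≢q , only with resolving⇒separates resolving p≢q
    ...   | w , w∈S , differ = w , w∈S , only w differ

  isMDim-tabulate : ∀ {k} (L : Fin k → V H) → Injective _≡_ _≡_ L →
    MixedResolving H (tabulate L) → (∀ S → MixedResolving H S → k ≤ length S) →
    IsMDim H k
  isMDim-tabulate L L-injective resolving minimal =
    (tabulate L , tabulate⁺ L-injective , resolving , length-tabulate L) ,
    λ S _ → minimal S

module Gₙ (n : ℕ) where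

  d : GV n → GV n → ℕ
  d x     x     = 0
  d x     y     = 1
  d x     (z _) = 1
  d y     x     = 1
  d y     y     = 0
  d y     (z _) = 1
  d (z _) x     = 1
  d (z _) y     = 1
  d (z i) (z j) = ifEq i j 0 2

  d-refl : ∀ v → d v v ≡ 0
  d-refl x     = refl
  d-refl y     = refl
  d-refl (z i) = ifEq-refl i 0 2

  d-lipschitz-edge : ∀ e v → let (u , w) = GEnds n e in d u v ≤ suc (d w v) × d w v ≤ suc (d u v)
  d-lipschitz-edge xy     x = ≤-eval , ≤-eval
  d-lipschitz-edge xy     y = ≤-eval , ≤-eval
  d-lipschitz-edge xy     (z j) = ≤-eval , ≤-eval
  d-lipschitz-edge (xz i) x = ≤-eval , ≤-eval
  d-lipschitz-edge (xz i) y = ≤-eval , ≤-eval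
  d-lipschitz-edge (xz i) (z j) with i ≟ j
  ... | yes _ = ≤-eval , ≤-eval
  ... | no _  = ≤-eval , ≤-eval
  d-lipschitz-edge (yz i) x = ≤-eval , ≤-eval
  d-lipschitz-edge (yz i) y = ≤-eval , ≤-eval
  d-lipschitz-edge (yz i) (z j) with i ≟ j
  ... | yes _ = ≤-eval , ≤-eval
  ... | no _  = ≤-eval , ≤-eval

  d-lipschitz : ∀ {u w} → Adj (G n) u w → ∀ v → d u v ≤ suc (d w v)
  d-lipschitz (e , inj₁ ends≡) v with GEnds n e | d-lipschitz-edge e v
  d-lipschitz (e , inj₁ refl)  v | _ | forward , _ = forward
  d-lipschitz (e , inj₂ ends≡) v with GEnds n e | d-lipschitz-edge e v
  d-lipschitz (e , inj₂ refl)  v | _ | _ , backward = backward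

  along : ∀ e → Adj (G n) (proj₁ (GEnds n e)) (proj₂ (GEnds n e))
  along e = e , inj₁ refl

  against : ∀ e → Adj (G n) (proj₂ (GEnds n e)) (proj₁ (GEnds n e))
  against e = e , inj₂ refl

  d-realised : ∀ u v → Walk (G n) u v (d u v)
  d-realised x     x     = nil
  d-realised x     y     = step (along xy) nil
  d-realised x     (z j) = step (along (xz j)) nil
  d-realised y     x     = step (against xy) nil
  d-realised y     y     = nil
  d-realised y     (z j) = step (along (yz j)) nil
  d-realised (z i) x     = step (against (xz i)) nil
  d-realised (z i) y     = step (against (yz i)) nil
  d-realised (z i) (z j) with i ≟ j
  ... | yes refl = nil
  ... | no _     = step (against (xz i)) (step (along (xz j)) nil)

  open ExactDistance (G n) d d-refl d-lipschitz d-realised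

  elemDist-injective : ∀ p q → elemDist p x ≡ elemDist q x → elemDist p y ≡ elemDist q y →
    (∀ i → elemDist p (z i) ≡ elemDist q (z i)) → p ≡ q
  elemDist-injective (inj₁ x) (inj₁ x) _ _ _ = refl
  elemDist-injective (inj₁ x) (inj₁ y) () _ _
  elemDist-injective (inj₁ x) (inj₁ (z j)) () _ _
  elemDist-injective (inj₁ x) (inj₂ xy) _ () _
  elemDist-injective (inj₁ x) (inj₂ (xz j)) _ _ hz =
    contradiction (trans (hz j) (cong (1 ⊓_) (ifEq-refl j 0 2))) λ ()
  elemDist-injective (inj₁ x) (inj₂ (yz j)) () _ _
  elemDist-injective (inj₁ y) (inj₁ x) () _ _
  elemDist-injective (inj₁ y) (inj₁ y) _ _ _ = refl
  elemDist-injective (inj₁ y) (inj₁ (z j)) _ () _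
  elemDist-injective (inj₁ y) (inj₂ xy) () _ _
  elemDist-injective (inj₁ y) (inj₂ (xz j)) () _ _
  elemDist-injective (inj₁ y) (inj₂ (yz j)) _ _ hz =
    contradiction (trans (hz j) (cong (1 ⊓_) (ifEq-refl j 0 2))) λ ()
  elemDist-injective (inj₁ (z i)) (inj₁ x) () _ _
  elemDist-injective (inj₁ (z i)) (inj₁ y) _ () _
  elemDist-injective (inj₁ (z i)) (inj₁ (z j)) _ _ hz =
    cong (inj₁ ∘ z) (ifEq-≡-diagonal⇒≡ id j i (λ ()) (sym (hz j)))
  elemDist-injective (inj₁ (z i)) (inj₂ xy) () _ _
  elemDist-injective (inj₁ (z i)) (inj₂ (xz j)) () _ _
  elemDist-injective (inj₁ (z i)) (inj₂ (yz j)) _ () _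
  elemDist-injective (inj₂ xy) (inj₁ x) _ () _
  elemDist-injective (inj₂ xy) (inj₁ y) () _ _
  elemDist-injective (inj₂ xy) (inj₁ (z j)) () _ _
  elemDist-injective (inj₂ xy) (inj₂ xy) _ _ _ = refl
  elemDist-injective (inj₂ xy) (inj₂ (xz j)) _ () _
  elemDist-injective (inj₂ xy) (inj₂ (yz j)) () _ _
  elemDist-injective (inj₂ (xz i)) (inj₁ x) _ _ hz =
    contradiction (trans (sym (hz i)) (cong (1 ⊓_) (ifEq-refl i 0 2))) λ ()
  elemDist-injective (inj₂ (xz i)) (inj₁ y) () _ _
  elemDist-injective (inj₂ (xz i)) (inj₁ (z j)) () _ _
  elemDist-injective (inj₂ (xz i)) (inj₂ xy) _ () _
  elemDist-injective (inj₂ (xz i)) (inj₂ (xz j)) _ _ hz =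
    cong (inj₂ ∘ xz) (ifEq-≡-diagonal⇒≡ (1 ⊓_) j i (λ ()) (sym (hz j)))
  elemDist-injective (inj₂ (xz i)) (inj₂ (yz j)) () _ _
  elemDist-injective (inj₂ (yz i)) (inj₁ x) () _ _
  elemDist-injective (inj₂ (yz i)) (inj₁ y) _ _ hz =
    contradiction (trans (sym (hz i)) (cong (1 ⊓_) (ifEq-refl i 0 2))) λ ()
  elemDist-injective (inj₂ (yz i)) (inj₁ (z j)) _ () _
  elemDist-injective (inj₂ (yz i)) (inj₂ xy) () _ _
  elemDist-injective (inj₂ (yz i)) (inj₂ (xz j)) () _ _
  elemDist-injective (inj₂ (yz i)) (inj₂ (yz j)) _ _ hz =
    cong (inj₂ ∘ yz) (ifEq-≡-diagonal⇒≡ (1 ⊓_) j i (λ ()) (sym (hz j)))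

  vertex : Fin (2 + n) → GV n
  vertex zero          = x
  vertex (suc zero)    = y
  vertex (suc (suc i)) = z i

  vertex-injective : Injective _≡_ _≡_ vertex
  vertex-injective {zero}        {zero}        _    = refl
  vertex-injective {suc zero}    {suc zero}    _    = refl
  vertex-injective {suc (suc i)} {suc (suc i)} refl = refl
  vertex-injective {zero}        {suc zero}    ()
  vertex-injective {zero}        {suc (suc _)} ()
  vertex-injective {suc zero}    {zero}        ()
  vertex-injective {suc zero}    {suc (suc _)} ()
  vertex-injective {suc (suc _)} {zero}        ()
  vertex-injective {suc (suc _)} {suc zero}    ()

  vertices-resolving : MixedResolving (G n) (tabulate vertex)
  vertices-resolving = tabulate-resolving vertex λ p q agree →
    elemDist-injective p q (agree zero) (agree (suc zero)) (λ i → agree (suc (suc i)))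

  every-vertex-forced : ∀ k → SeparatedOnlyWithin (_≡ vertex k)
  every-vertex-forced zero = inj₁ y , inj₂ xy , (λ ()) , only
    where
    only : ∀ w → elemDist (inj₁ y) w ≢ elemDist (inj₂ xy) w → w ≡ x
    only x     _      = refl
    only y     differ = contradiction refl differ
    only (z _) differ = contradiction refl differ
  every-vertex-forced (suc zero) = inj₁ x , inj₂ xy , (λ ()) , only
    where
    only : ∀ w → elemDist (inj₁ x) w ≢ elemDist (inj₂ xy) w → w ≡ y
    only x     differ = contradiction refl differ
    only y     _      = refl
    only (z _) differ = contradiction refl differ
  every-vertex-forced (suc (suc i)) = inj₁ x , inj₂ (xz i) , (λ ()) , only
    where
    only : ∀ w → elemDist (inj₁ x) w ≢ elemDist (inj₂ (xz i)) w → w ≡ z i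
    only x     differ = contradiction refl differ
    only y     differ = contradiction refl differ
    only (z j) differ with i ≟ j
    ... | yes refl = refl
    ... | no _     = contradiction refl differ

  mdim : IsMDim (G n) (2 + n)
  mdim = isMDim-tabulate vertex vertex-injective vertices-resolving
    (resolving-length-≥ (λ k w → w ≡ vertex k) (λ w≡k w≡l → vertex-injective (trans (sym w≡k) w≡l))
      every-vertex-forced)

-- Vertices of S(G n): the original ones, and M, A i, B i subdividing x y, x z_i, y z_i.
pattern X   = inj₁ x
pattern Y   = inj₁ y
pattern Z i = inj₁ (z i)
pattern M   = inj₂ xy
pattern A i = inj₂ (xz i)
pattern B i = inj₂ (yz i)

module S[Gₙ] (n : ℕ) where

  SG : Graph
  SG = Subdiv (G n)

  d : V SG → V SG → ℕ
  d X     X     = 0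
  d X     Y     = 2
  d X     M     = 1
  d X     (A j) = 1
  d X     (Z j) = 2
  d X     (B j) = 3
  d Y     X     = 2
  d Y     Y     = 0
  d Y     M     = 1
  d Y     (A j) = 3
  d Y     (Z j) = 2
  d Y     (B j) = 1
  d M     X     = 1
  d M     Y     = 1
  d M     M     = 0
  d M     (A j) = 2
  d M     (Z j) = 3
  d M     (B j) = 2
  d (A i) X     = 1
  d (A i) Y     = 3
  d (A i) M     = 2
  d (A i) (A j) = ifEq i j 0 2
  d (A i) (Z j) = ifEq i j 1 3
  d (A i) (B j) = ifEq i j 2 4
  d (Z i) X     = 2
  d (Z i) Y     = 2
  d (Z i) M     = 3
  d (Z i) (A j) = ifEq i j 1 3
  d (Z i) (Z j) = ifEq i j 0 4
  d (Z i) (B j) = ifEq i j 1 3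
  d (B i) X     = 3
  d (B i) Y     = 1
  d (B i) M     = 2
  d (B i) (A j) = ifEq i j 2 4
  d (B i) (Z j) = ifEq i j 1 3
  d (B i) (B j) = ifEq i j 0 2

  d-refl : ∀ v → d v v ≡ 0
  d-refl X     = refl
  d-refl Y     = refl
  d-refl M     = refl
  d-refl (A i) = ifEq-refl i 0 2
  d-refl (Z i) = ifEq-refl i 0 4
  d-refl (B i) = ifEq-refl i 0 2

  along : ∀ e → Adj SG (proj₁ (ends SG e)) (proj₂ (ends SG e))
  along e = e , inj₁ refl

  against : ∀ e → Adj SG (proj₂ (ends SG e)) (proj₁ (ends SG e))
  against e = e , inj₂ refl

  d-realised : ∀ u v → Walk SG u v (d u v)
  d-realised X X = nil
  d-realised X Y = step (along (xy , false)) (step (along (xy , true)) nil)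
  d-realised X M = step (along (xy , false)) nil
  d-realised X (A j) = step (along (xz j , false)) nil
  d-realised X (Z j) = step (along (xz j , false)) (step (along (xz j , true)) nil)
  d-realised X (B j) = step (along (xy , false)) (step (along (xy , true)) (step (along (yz j , false)) nil))
  d-realised Y X = step (against (xy , true)) (step (against (xy , false)) nil)
  d-realised Y Y = nil
  d-realised Y M = step (against (xy , true)) nil
  d-realised Y (A j) = step (against (xy , true)) (step (against (xy , false)) (step (along (xz j , false)) nil))
  d-realised Y (Z j) = step (along (yz j , false)) (step (along (yz j , true)) nil)
  d-realised Y (B j) = step (along (yz j , false)) nil
  d-realised M X = step (against (xy , false)) nil
  d-realised M Y = step (along (xy , true)) nil
  d-realised M M = nil
  d-realised M (A j) = step (against (xy , false)) (step (along (xz j , false)) nil)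
  d-realised M (Z j) = step (against (xy , false)) (step (along (xz j , false)) (step (along (xz j , true)) nil))
  d-realised M (B j) = step (along (xy , true)) (step (along (yz j , false)) nil)
  d-realised (A i) X = step (against (xz i , false)) nil
  d-realised (A i) Y = step (against (xz i , false)) (step (along (xy , false)) (step (along (xy , true)) nil))
  d-realised (A i) M = step (against (xz i , false)) (step (along (xy , false)) nil)
  d-realised (A i) (A j) with i ≟ j
  ... | yes refl = nil
  ... | no _ = step (against (xz i , false)) (step (along (xz j , false)) nil)
  d-realised (A i) (Z j) with i ≟ j
  ... | yes refl = step (along (xz i , true)) nil
  ... | no _ = step (against (xz i , false)) (step (along (xz j , false)) (step (along (xz j , true)) nil))
  d-realised (A i) (B j) with i ≟ j
  ... | yes refl = step (along (xz i , true)) (step (against (yz i , true)) nil)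
  ... | no _ = step (against (xz i , false)) (step (along (xy , false)) (step (along (xy , true)) (step (along (yz j , false)) nil)))
  d-realised (Z i) X = step (against (xz i , true)) (step (against (xz i , false)) nil)
  d-realised (Z i) Y = step (against (yz i , true)) (step (against (yz i , false)) nil)
  d-realised (Z i) M = step (against (xz i , true)) (step (against (xz i , false)) (step (along (xy , false)) nil))
  d-realised (Z i) (A j) with i ≟ j
  ... | yes refl = step (against (xz i , true)) nil
  ... | no _ = step (against (xz i , true)) (step (against (xz i , false)) (step (along (xz j , false)) nil))
  d-realised (Z i) (Z j) with i ≟ j
  ... | yes refl = nil
  ... | no _ = step (against (xz i , true)) (step (against (xz i , false)) (step (along (xz j , false)) (step (along (xz j , true)) nil)))
  d-realised (Z i) (B j) with i ≟ j
  ... | yes refl = step (against (yz i , true)) nil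
  ... | no _ = step (against (yz i , true)) (step (against (yz i , false)) (step (along (yz j , false)) nil))
  d-realised (B i) X = step (against (yz i , false)) (step (against (xy , true)) (step (against (xy , false)) nil))
  d-realised (B i) Y = step (against (yz i , false)) nil
  d-realised (B i) M = step (against (yz i , false)) (step (against (xy , true)) nil)
  d-realised (B i) (A j) with i ≟ j
  ... | yes refl = step (along (yz i , true)) (step (against (xz i , true)) nil)
  ... | no _ = step (against (yz i , false)) (step (against (xy , true)) (step (against (xy , false)) (step (along (xz j , false)) nil)))
  d-realised (B i) (Z j) with i ≟ j
  ... | yes refl = step (along (yz i , true)) nil
  ... | no _ = step (against (yz i , false)) (step (along (yz j , false)) (step (along (yz j , true)) nil))
  d-realised (B i) (B j) with i ≟ j
  ... | yes refl = nil
  ... | no _ = step (against (yz i , false)) (step (along (yz j , false)) nil)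

  d-lipschitz-edge : ∀ e v → let (u , w) = ends SG e in d u v ≤ suc (d w v) × d w v ≤ suc (d u v)
  d-lipschitz-edge (xy , false) X = ≤-eval , ≤-eval
  d-lipschitz-edge (xy , false) Y = ≤-eval , ≤-eval
  d-lipschitz-edge (xy , false) M = ≤-eval , ≤-eval
  d-lipschitz-edge (xy , false) (A j) = ≤-eval , ≤-eval
  d-lipschitz-edge (xy , false) (Z j) = ≤-eval , ≤-eval
  d-lipschitz-edge (xy , false) (B j) = ≤-eval , ≤-eval
  d-lipschitz-edge (xy , true) X = ≤-eval , ≤-eval
  d-lipschitz-edge (xy , true) Y = ≤-eval , ≤-eval
  d-lipschitz-edge (xy , true) M = ≤-eval , ≤-eval
  d-lipschitz-edge (xy , true) (A j) = ≤-eval , ≤-eval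
  d-lipschitz-edge (xy , true) (Z j) = ≤-eval , ≤-eval
  d-lipschitz-edge (xy , true) (B j) = ≤-eval , ≤-eval
  d-lipschitz-edge (xz i , false) X = ≤-eval , ≤-eval
  d-lipschitz-edge (xz i , false) Y = ≤-eval , ≤-eval
  d-lipschitz-edge (xz i , false) M = ≤-eval , ≤-eval
  d-lipschitz-edge (xz i , false) (A j) with i ≟ j
  ... | yes _ = ≤-eval , ≤-eval
  ... | no _  = ≤-eval , ≤-eval
  d-lipschitz-edge (xz i , false) (Z j) with i ≟ j
  ... | yes _ = ≤-eval , ≤-eval
  ... | no _  = ≤-eval , ≤-eval
  d-lipschitz-edge (xz i , false) (B j) with i ≟ j
  ... | yes _ = ≤-eval , ≤-eval
  ... | no _  = ≤-eval , ≤-eval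
  d-lipschitz-edge (xz i , true) X = ≤-eval , ≤-eval
  d-lipschitz-edge (xz i , true) Y = ≤-eval , ≤-eval
  d-lipschitz-edge (xz i , true) M = ≤-eval , ≤-eval
  d-lipschitz-edge (xz i , true) (A j) with i ≟ j
  ... | yes _ = ≤-eval , ≤-eval
  ... | no _  = ≤-eval , ≤-eval
  d-lipschitz-edge (xz i , true) (Z j) with i ≟ j
  ... | yes _ = ≤-eval , ≤-eval
  ... | no _  = ≤-eval , ≤-eval
  d-lipschitz-edge (xz i , true) (B j) with i ≟ j
  ... | yes _ = ≤-eval , ≤-eval
  ... | no _  = ≤-eval , ≤-eval
  d-lipschitz-edge (yz i , false) X = ≤-eval , ≤-eval
  d-lipschitz-edge (yz i , false) Y = ≤-eval , ≤-eval
  d-lipschitz-edge (yz i , false) M = ≤-eval , ≤-eval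
  d-lipschitz-edge (yz i , false) (A j) with i ≟ j
  ... | yes _ = ≤-eval , ≤-eval
  ... | no _  = ≤-eval , ≤-eval
  d-lipschitz-edge (yz i , false) (Z j) with i ≟ j
  ... | yes _ = ≤-eval , ≤-eval
  ... | no _  = ≤-eval , ≤-eval
  d-lipschitz-edge (yz i , false) (B j) with i ≟ j
  ... | yes _ = ≤-eval , ≤-eval
  ... | no _  = ≤-eval , ≤-eval
  d-lipschitz-edge (yz i , true) X = ≤-eval , ≤-eval
  d-lipschitz-edge (yz i , true) Y = ≤-eval , ≤-eval
  d-lipschitz-edge (yz i , true) M = ≤-eval , ≤-eval
  d-lipschitz-edge (yz i , true) (A j) with i ≟ j
  ... | yes _ = ≤-eval , ≤-eval
  ... | no _  = ≤-eval , ≤-eval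
  d-lipschitz-edge (yz i , true) (Z j) with i ≟ j
  ... | yes _ = ≤-eval , ≤-eval
  ... | no _  = ≤-eval , ≤-eval
  d-lipschitz-edge (yz i , true) (B j) with i ≟ j
  ... | yes _ = ≤-eval , ≤-eval
  ... | no _  = ≤-eval , ≤-eval

  d-lipschitz : ∀ {u w} → Adj SG u w → ∀ v → d u v ≤ suc (d w v)
  d-lipschitz (e , inj₁ ends≡) v with ends SG e | d-lipschitz-edge e v
  d-lipschitz (e , inj₁ refl)  v | _ | forward , _ = forward
  d-lipschitz (e , inj₂ ends≡) v with ends SG e | d-lipschitz-edge e v
  d-lipschitz (e , inj₂ refl)  v | _ | _ , backward = backward

  open ExactDistance SG d d-refl d-lipschitz d-realised public

  branchOf : V SG → Maybe (Fin n)
  branchOf (A i) = just i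
  branchOf (Z i) = just i
  branchOf (B i) = just i
  branchOf X     = nothing
  branchOf Y     = nothing
  branchOf M     = nothing

  every-branch-forced : ∀ i → SeparatedOnlyWithin (λ w → branchOf w ≡ just i)
  every-branch-forced i = inj₁ X , inj₂ (xz i , false) , (λ ()) , only
    where
    only : ∀ w → elemDist (inj₁ X) w ≢ elemDist (inj₂ (xz i , false)) w → branchOf w ≡ just i
    only X differ = contradiction refl differ
    only Y differ = contradiction refl differ
    only M differ = contradiction refl differ
    only (A j) differ with i ≟ j
    ... | yes refl = refl
    ... | no _     = contradiction refl differ
    only (Z j) differ with i ≟ j
    ... | yes refl = refl
    ... | no _     = contradiction refl differ
    only (B j) differ with i ≟ j
    ... | yes refl = refl
    ... | no _     = contradiction refl differ

  resolving-length-≥n : ∀ S → MixedResolving SG S → n ≤ length S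
  resolving-length-≥n = resolving-length-≥ (λ i w → branchOf w ≡ just i)
    (λ w∈i w∈j → just-injective (trans (sym w∈i) w∈j)) every-branch-forced

  data CoreKind : Set where
    atX atY atM edgeXM edgeMY : CoreKind

  data BranchKind : Set where
    atA atZ atB edgeXA edgeAZ edgeZB edgeBY : BranchKind

  data Position : Set where
    core   : CoreKind → Position
    branch : BranchKind → Fin n → Position

  position : Elem SG → Position
  position (inj₁ X)              = core atX
  position (inj₁ Y)              = core atY
  position (inj₁ M)              = core atM
  position (inj₂ (xy , false))   = core edgeXM
  position (inj₂ (xy , true))    = core edgeMY
  position (inj₁ (A i))          = branch atA i
  position (inj₁ (Z i))          = branch atZ i
  position (inj₁ (B i))          = branch atB i
  position (inj₂ (xz i , false)) = branch edgeXA i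
  position (inj₂ (xz i , true))  = branch edgeAZ i
  position (inj₂ (yz i , true))  = branch edgeZB i
  position (inj₂ (yz i , false)) = branch edgeBY i

  element : Position → Elem SG
  element (core atX)        = inj₁ X
  element (core atY)        = inj₁ Y
  element (core atM)        = inj₁ M
  element (core edgeXM)     = inj₂ (xy , false)
  element (core edgeMY)     = inj₂ (xy , true)
  element (branch atA i)    = inj₁ (A i)
  element (branch atZ i)    = inj₁ (Z i)
  element (branch atB i)    = inj₁ (B i)
  element (branch edgeXA i) = inj₂ (xz i , false)
  element (branch edgeAZ i) = inj₂ (xz i , true)
  element (branch edgeZB i) = inj₂ (yz i , true)
  element (branch edgeBY i) = inj₂ (yz i , false)

  element-position : ∀ p → element (position p) ≡ p
  element-position (inj₁ X)              = refl
  element-position (inj₁ Y)              = refl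
  element-position (inj₁ M)              = refl
  element-position (inj₂ (xy , false))   = refl
  element-position (inj₂ (xy , true))    = refl
  element-position (inj₁ (A i))          = refl
  element-position (inj₁ (Z i))          = refl
  element-position (inj₁ (B i))          = refl
  element-position (inj₂ (xz i , false)) = refl
  element-position (inj₂ (xz i , true))  = refl
  element-position (inj₂ (yz i , true))  = refl
  element-position (inj₂ (yz i , false)) = refl

  data Side : Set where
    sideA sideB : Side

  landmark : Side → Fin n → V SG
  landmark sideA j = A j
  landmark sideB j = B j

  coreDist : CoreKind → Side → ℕ
  coreDist atX    sideA = 1
  coreDist atX    sideB = 3
  coreDist atY    sideA = 3
  coreDist atY    sideB = 1
  coreDist atM    _     = 2
  coreDist edgeXM sideA = 1
  coreDist edgeXM sideB = 2
  coreDist edgeMY sideA = 2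
  coreDist edgeMY sideB = 1

  nearDist farDist : BranchKind → Side → ℕ
  nearDist atA    sideA = 0
  nearDist atA    sideB = 2
  nearDist atZ    _     = 1
  nearDist atB    sideA = 2
  nearDist atB    sideB = 0
  nearDist edgeXA sideA = 0
  nearDist edgeXA sideB = 2
  nearDist edgeAZ sideA = 0
  nearDist edgeAZ sideB = 1
  nearDist edgeZB sideA = 1
  nearDist edgeZB sideB = 0
  nearDist edgeBY sideA = 2
  nearDist edgeBY sideB = 0
  farDist atA    sideA = 2
  farDist atA    sideB = 4
  farDist atZ    _     = 3
  farDist atB    sideA = 4
  farDist atB    sideB = 2
  farDist edgeXA sideA = 1
  farDist edgeXA sideB = 3
  farDist edgeAZ sideA = 2
  farDist edgeAZ sideB = 3
  farDist edgeZB sideA = 3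
  farDist edgeZB sideB = 2
  farDist edgeBY sideA = 3
  farDist edgeBY sideB = 1

  profile : Position → Side → Fin n → ℕ
  profile (core c)     s j = coreDist c s
  profile (branch b i) s j = ifEq i j (nearDist b s) (farDist b s)

  elemDist-landmark : ∀ s p j → elemDist p (landmark s j) ≡ profile (position p) s j
  elemDist-landmark sideA (inj₁ X) j = refl
  elemDist-landmark sideA (inj₁ Y) j = refl
  elemDist-landmark sideA (inj₁ M) j = refl
  elemDist-landmark sideA (inj₂ (xy , false)) j = refl
  elemDist-landmark sideA (inj₂ (xy , true)) j = refl
  elemDist-landmark sideA (inj₁ (A i)) j with i ≟ j
  ... | yes _ = refl
  ... | no _  = refl
  elemDist-landmark sideA (inj₁ (Z i)) j with i ≟ j
  ... | yes _ = refl
  ... | no _  = refl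
  elemDist-landmark sideA (inj₁ (B i)) j with i ≟ j
  ... | yes _ = refl
  ... | no _  = refl
  elemDist-landmark sideA (inj₂ (xz i , false)) j with i ≟ j
  ... | yes _ = refl
  ... | no _  = refl
  elemDist-landmark sideA (inj₂ (xz i , true)) j with i ≟ j
  ... | yes _ = refl
  ... | no _  = refl
  elemDist-landmark sideA (inj₂ (yz i , true)) j with i ≟ j
  ... | yes _ = refl
  ... | no _  = refl
  elemDist-landmark sideA (inj₂ (yz i , false)) j with i ≟ j
  ... | yes _ = refl
  ... | no _  = refl
  elemDist-landmark sideB (inj₁ X) j = refl
  elemDist-landmark sideB (inj₁ Y) j = refl
  elemDist-landmark sideB (inj₁ M) j = refl
  elemDist-landmark sideB (inj₂ (xy , false)) j = refl
  elemDist-landmark sideB (inj₂ (xy , true)) j = refl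
  elemDist-landmark sideB (inj₁ (A i)) j with i ≟ j
  ... | yes _ = refl
  ... | no _  = refl
  elemDist-landmark sideB (inj₁ (Z i)) j with i ≟ j
  ... | yes _ = refl
  ... | no _  = refl
  elemDist-landmark sideB (inj₁ (B i)) j with i ≟ j
  ... | yes _ = refl
  ... | no _  = refl
  elemDist-landmark sideB (inj₂ (xz i , false)) j with i ≟ j
  ... | yes _ = refl
  ... | no _  = refl
  elemDist-landmark sideB (inj₂ (xz i , true)) j with i ≟ j
  ... | yes _ = refl
  ... | no _  = refl
  elemDist-landmark sideB (inj₂ (yz i , true)) j with i ≟ j
  ... | yes _ = refl
  ... | no _  = refl
  elemDist-landmark sideB (inj₂ (yz i , false)) j with i ≟ j
  ... | yes _ = refl
  ... | no _  = refl

  near<far : ∀ b s → nearDist b s < farDist b s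
  near<far atA sideA = ≤-eval
  near<far atA sideB = ≤-eval
  near<far atZ sideA = ≤-eval
  near<far atZ sideB = ≤-eval
  near<far atB sideA = ≤-eval
  near<far atB sideB = ≤-eval
  near<far edgeXA sideA = ≤-eval
  near<far edgeXA sideB = ≤-eval
  near<far edgeAZ sideA = ≤-eval
  near<far edgeAZ sideB = ≤-eval
  near<far edgeZB sideA = ≤-eval
  near<far edgeZB sideB = ≤-eval
  near<far edgeBY sideA = ≤-eval
  near<far edgeBY sideB = ≤-eval

  coreKind : ℕ → ℕ → CoreKind
  coreKind 1 3 = atX
  coreKind 3 1 = atY
  coreKind 2 2 = atM
  coreKind 1 2 = edgeXM
  coreKind 2 1 = edgeMY
  coreKind _ _ = atX

  coreKind-coreDist : ∀ c → coreKind (coreDist c sideA) (coreDist c sideB) ≡ c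
  coreKind-coreDist atX    = refl
  coreKind-coreDist atY    = refl
  coreKind-coreDist atM    = refl
  coreKind-coreDist edgeXM = refl
  coreKind-coreDist edgeMY = refl

  coreDist-injective : ∀ {c c'} → coreDist c sideA ≡ coreDist c' sideA →
    coreDist c sideB ≡ coreDist c' sideB → c ≡ c'
  coreDist-injective {c} {c'} eqA eqB = begin
    c                                           ≡⟨ coreKind-coreDist c ⟨
    coreKind (coreDist c sideA) (coreDist c sideB)   ≡⟨ cong₂ coreKind eqA eqB ⟩
    coreKind (coreDist c' sideA) (coreDist c' sideB) ≡⟨ coreKind-coreDist c' ⟩
    c'                                          ∎

  branchKind : ℕ → ℕ → BranchKind
  branchKind 2 4 = atA
  branchKind 3 3 = atZ
  branchKind 4 2 = atB
  branchKind 1 3 = edgeXA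
  branchKind 2 3 = edgeAZ
  branchKind 3 2 = edgeZB
  branchKind 3 1 = edgeBY
  branchKind _ _ = atA

  branchKind-farDist : ∀ b → branchKind (farDist b sideA) (farDist b sideB) ≡ b
  branchKind-farDist atA    = refl
  branchKind-farDist atZ    = refl
  branchKind-farDist atB    = refl
  branchKind-farDist edgeXA = refl
  branchKind-farDist edgeAZ = refl
  branchKind-farDist edgeZB = refl
  branchKind-farDist edgeBY = refl

  farDist-injective : ∀ {b b'} → farDist b sideA ≡ farDist b' sideA →
    farDist b sideB ≡ farDist b' sideB → b ≡ b'
  farDist-injective {b} {b'} eqA eqB = begin
    b                                             ≡⟨ branchKind-farDist b ⟨
    branchKind (farDist b sideA) (farDist b sideB)   ≡⟨ cong₂ branchKind eqA eqB ⟩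
    branchKind (farDist b' sideA) (farDist b' sideB) ≡⟨ branchKind-farDist b' ⟩
    b'                                            ∎

module S[G4+] (m : ℕ) where
  open S[Gₙ] (4 + m)

  side : Fin (4 + m) → Side
  side zero       = sideA
  side (suc zero) = sideA
  side _          = sideB

  landmarkAt : Fin (4 + m) → V SG
  landmarkAt j = landmark (side j) j

  landmarkAt-injective : Injective _≡_ _≡_ landmarkAt
  landmarkAt-injective {i} {j} = landmark-injective (side i) (side j)
    where
    landmark-injective : ∀ s t → landmark s i ≡ landmark t j → i ≡ j
    landmark-injective sideA sideA refl = refl
    landmark-injective sideB sideB refl = refl
    landmark-injective sideA sideB ()
    landmark-injective sideB sideA ()

  _≟ˢ_ : DecidableEquality Side
  sideA ≟ˢ sideA = yes refl
  sideB ≟ˢ sideB = yes refl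
  sideA ≟ˢ sideB = no λ ()
  sideB ≟ˢ sideA = no λ ()

  -- Each side carries at least two landmarks; this is where 4 ≤ n is used.
  elsewhere : ∀ s i → Σ (Fin (4 + m)) λ k → side k ≡ s × k ≢ i
  elsewhere sideA zero                      = suc zero , refl , λ ()
  elsewhere sideA (suc _)                   = zero , refl , λ ()
  elsewhere sideB (suc (suc zero))          = suc (suc (suc zero)) , refl , λ ()
  elsewhere sideB zero                      = suc (suc zero) , refl , λ ()
  elsewhere sideB (suc zero)                = suc (suc zero) , refl , λ ()
  elsewhere sideB (suc (suc (suc _)))       = suc (suc zero) , refl , λ ()

  Avoiding : Side → Fin (4 + m) → Fin (4 + m) → Set
  Avoiding s i j = Σ (Fin (4 + m)) λ k → side k ≡ s × k ≢ i × k ≢ j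

  avoiding-same : ∀ s i → Avoiding s i i
  avoiding-same s i with elsewhere s i
  ... | k , side-k , k≢i = k , side-k , k≢i , k≢i

  avoiding-across : ∀ s {i j} → side i ≢ side j → Avoiding s i j
  avoiding-across s {i} {j} sides-differ with side i ≟ˢ s
  ... | yes side-i with elsewhere s i
  ...   | k , side-k , k≢i = k , side-k , k≢i ,
          λ { refl → sides-differ (trans side-i (sym side-k)) }
  avoiding-across s {i} {j} sides-differ | no side-i≢s with elsewhere s j
  ...   | k , side-k , k≢j = k , side-k , (λ { refl → side-i≢s side-k }) , k≢j

  signature : Position → Fin (4 + m) → ℕ
  signature P j = profile P (side j) j

  Agree : Position → Position → Set
  Agree P Q = ∀ j → signature P j ≡ signature Q j

  signature-near : ∀ b i → signature (branch b i) i ≡ nearDist b (side i)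
  signature-near b i = ifEq-refl i _ _

  signature-far : ∀ b {i k} → k ≢ i → signature (branch b i) k ≡ farDist b (side k)
  signature-far b k≢i = ifEq-≢ _ _ (≢-sym k≢i)

  near≢far : ∀ b s → nearDist b s ≢ farDist b s
  near≢far b s eq = ℕ.<-irrefl eq (near<far b s)

  branchKind-determined : ∀ {b b' i j} → Agree (branch b i) (branch b' j) →
    (∀ s → Avoiding s i j) → b ≡ b'
  branchKind-determined {b} {b'} {i} {j} agree avoid = farDist-injective (far-agrees sideA) (far-agrees sideB)
    where
    far-agrees : ∀ s → farDist b s ≡ farDist b' s
    far-agrees s with avoid s
    ... | k , refl , k≢i , k≢j = begin
      farDist b (side k)        ≡⟨ signature-far b k≢i ⟨
      signature (branch b i) k  ≡⟨ agree k ⟩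
      signature (branch b' j) k ≡⟨ signature-far b' k≢j ⟩
      farDist b' (side k)       ∎

  core≁branch : ∀ c b i → ¬ Agree (core c) (branch b i)
  core≁branch c b i agree with elsewhere (side i) i
  ... | k , side-k , k≢i = near≢far b (side i) (begin
    nearDist b (side i)        ≡⟨ signature-near b i ⟨
    signature (branch b i) i   ≡⟨ agree i ⟨
    coreDist c (side i)        ≡⟨ cong (coreDist c) side-k ⟨
    signature (core c) k       ≡⟨ agree k ⟩
    signature (branch b i) k   ≡⟨ signature-far b k≢i ⟩
    farDist b (side k)         ≡⟨ cong (farDist b) side-k ⟩
    farDist b (side i)         ∎)

  -- near b < far b = near b' < far b' = near b
  no-crossing : ∀ b b' s → nearDist b s ≡ farDist b' s → farDist b s ≡ nearDist b' s → ⊥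
  no-crossing b b' s near≡far far≡near = ℕ.<-asym
    (subst (nearDist b s <_) far≡near (near<far b s))
    (subst (nearDist b' s <_) (sym near≡far) (near<far b' s))

  branches-agree : ∀ b b' i j → Agree (branch b i) (branch b' j) → branch b i ≡ branch b' j
  branches-agree b b' i j agree with i ≟ j
  ... | yes refl = cong (λ b → branch b i) (branchKind-determined agree λ s → avoiding-same s i)
  ... | no i≢j with side i ≟ˢ side j
  ...   | yes same = ⊥-elim (no-crossing b b' (side i) at-i
          (subst (λ s → farDist b s ≡ nearDist b' s) (sym same) at-j))
    where
    at-i : nearDist b (side i) ≡ farDist b' (side i)
    at-i = trans (sym (signature-near b i)) (trans (agree i) (signature-far b' i≢j))
    at-j : farDist b (side j) ≡ nearDist b' (side j)
    at-j = trans (sym (signature-far b (≢-sym i≢j))) (trans (agree j) (signature-near b' j))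
  ...   | no differ with branchKind-determined agree (λ s → avoiding-across s differ)
  ...     | refl = ⊥-elim (near≢far b (side i)
            (trans (sym (signature-near b i)) (trans (agree i) (signature-far b i≢j))))

  agree⇒≡ : ∀ P Q → Agree P Q → P ≡ Q
  agree⇒≡ (core c)     (core c')     agree = cong core (coreDist-injective (agree zero) (agree (suc (suc zero))))
  agree⇒≡ (core c)     (branch b i)  agree = ⊥-elim (core≁branch c b i agree)
  agree⇒≡ (branch b i) (core c)      agree = ⊥-elim (core≁branch c b i λ j → sym (agree j))
  agree⇒≡ (branch b i) (branch b' j) agree = branches-agree b b' i j agree

  landmarks-resolving : MixedResolving SG (tabulate landmarkAt)
  landmarks-resolving = tabulate-resolving landmarkAt λ p q agree → begin
    p                      ≡⟨ element-position p ⟨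
    element (position p)   ≡⟨ cong element (agree⇒≡ (position p) (position q) λ j → begin
      signature (position p) j       ≡⟨ elemDist-landmark (side j) p j ⟨
      elemDist p (landmarkAt j)      ≡⟨ agree j ⟩
      elemDist q (landmarkAt j)      ≡⟨ elemDist-landmark (side j) q j ⟩
      signature (position q) j       ∎) ⟩
    element (position q)   ≡⟨ element-position q ⟩
    q                      ∎

  mdim : IsMDim SG (4 + m)
  mdim = isMDim-tabulate landmarkAt landmarkAt-injective landmarks-resolving resolving-length-≥n

proposition3p3 : (n : ℕ) → 5 ≤ n →
    Σ ℕ λ a → Σ ℕ λ b → IsMDim (G n) a × IsMDim (Subdiv (G n)) b × 2 ≤ a ∸ b
proposition3p3 n (s≤s (s≤s (s≤s (s≤s {n = m} _)))) =
  2 + n , n , Gₙ.mdim n , S[G4+].mdim m , ℕ.≤-reflexive (sym (ℕ.m+n∸n≡m 2 n))
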